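{- Let $r\ge 1$ and $0\le \ell\le \lfloor (r-1)/2\rfloor$. Let $m=\binom{r}{r-\ell}$ and let $S_1,\dots,S_m$ be an enumeration of the $(r-\ell)$-element subsets of $[r]$. Define the hypergraph $\mathcal H^r_\ell$ with vertex set $\{0,1,\dots,m\}\times[r]$ and edge set $\{e_1,\dots,e_m\}$, where \[ e_i=\{(0,j): j\in S_i\}\cup\{(i,j): j\in [r]\setminus S_i\}. \] (It is $r$-uniform and $r$-partite with parts $P_j=\{(i,j):0\le i\le m\}$.) Then $\mathcal H^r_\ell$ is $(r-2\ell)$-intersecting and $\tau(\mathcal H^r_\ell)=\ell+1$.
   Context: A hypergraph is $s$-intersecting if any two of its edges $e,f$ satisfy $|e\cap f|\ge s$. A cover of a hypergraph $\mathcal H$ is a set $C\subseteq V(\mathcal H)$ with $C\cap e\neq\emptyset$ for every edge $e$; the cover number $\tau(\mathcal H)$ is the minimum size of a cover. -}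

module Defs where

open import Data.Nat using (ℕ; zero; suc; _*_; _≤_; _∸_)
open import Data.Fin using (Fin; zero; suc; remQuot; _≟_)
open import Data.Fin.Subset using (Subset; ∣_∣; _∩_; Nonempty; inside)
open import Data.Bool using (Bool; true; false; not; _∧_)
open import Data.Vec using (lookup; tabulate)
open import Data.Product using (Σ; _×_; _,_; ∃)
open import Relation.Binary.PropositionalEquality using (_≡_)
open import Relation.Nullary.Decidable using (⌊_⌋)
open import Function.Definitions using (Injective)

record Hypergraph : Set where
  field
    nV    : ℕ
    nE    : ℕ
    edge  : Fin nE → Subset nV
open Hypergraph public

Intersecting : ℕ → Hypergraph → Set
Intersecting s H = ∀ e f → s ≤ ∣ edge H e ∩ edge H f ∣

IsCover : (H : Hypergraph) → Subset (nV H) → Set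
IsCover H C = ∀ e → Nonempty (C ∩ edge H e)

CoverNumberIs : Hypergraph → ℕ → Set
CoverNumberIs H k =
  (Σ (Subset (nV H)) λ C → IsCover H C × ∣ C ∣ ≡ k)
  × (∀ C → IsCover H C → k ≤ ∣ C ∣)

IsEnumeration : (r t m : ℕ) → (Fin m → Subset r) → Set
IsEnumeration r t m S =
  Injective _≡_ _≡_ S
  × (∀ i → ∣ S i ∣ ≡ t)
  × (∀ T → ∣ T ∣ ≡ t → ∃ λ i → S i ≡ T)

-- Membership of vertex (a , j) ∈ {0..m} × [r] in e_i
-- (vertex 0 is Fin's zero, vertex suc k represents index k+1, i.e. e_{k+1}).
inEdge : ∀ {m r} → (Fin m → Subset r) → Fin m → Fin (suc m) → Fin r → Bool
inEdge S i zero    j = lookup (S i) j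
inEdge S i (suc k) j = ⌊ k ≟ i ⌋ ∧ not (lookup (S i) j)

Hrl : (r m : ℕ) → (Fin m → Subset r) → Hypergraph
Hrl r m S = record
  { nV   = suc m * r
  ; nE   = m
  ; edge = λ i → tabulate λ v → let (a , j) = remQuot r v in inEdge S i a j
  }
  where open import Data.Product using (_,_)

module Submission where

--  * Intersecting: e_i ∩ e_k already contains (S_i ∩ S_k) × {0}, and two
--    (r ∸ ℓ)-subsets of [r] share at least r ∸ 2ℓ points.
--  * Cover of size ℓ + 1: {0} × T for any (ℓ+1)-set T ⊆ [r], which meets every
--    S_i because |T| + |S_i| > r.
--  * No cover of size ≤ ℓ: if a cover K meets row 0 in t ≤ ℓ points, fix a set Z of
--    r ∸ ℓ ∸ 1 of the r ∸ t points missed by K in row 0; each of the ℓ + 1 ∸ t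
--    remaining missed points x gives an edge e_i with S_i = Z ∪ {x}, which K must
--    meet in row i + 1, the row of e_i alone.  These i are pairwise distinct, so by
--    pigeonhole K meets at least ℓ + 1 ∸ t rows besides row 0.

open import Defs
open import Data.Nat using (ℕ; zero; suc; _+_; _*_; _∸_; _≤_; _<_; _≤?_; z≤n; s≤s; ⌊_/2⌋)
open import Data.Nat.Properties
  using (+-0-commutativeMonoid; +-assoc; +-comm; +-identityʳ; +-mono-≤; +-monoʳ-≤;
         +-cancelʳ-≤; +-cancelˡ-≡; +-∸-assoc; ∸-+-assoc; [m+n]∸[m+o]≡n∸o; m+[n∸m]≡n;
         m+n∸n≡m; m∸n+n≡m; m≤m+n; m≤n+o⇒m∸n≤o; m≤n⇒m≤1+n; <⇒≤; ≤-pred; ≤-refl;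
         ≤-reflexive; ≤-trans; ≰⇒>; ⌊n/2⌋≤n; module ≤-Reasoning)
open import Data.Nat.Combinatorics using (_C_)
open import Data.Fin using (Fin; zero; suc; combine; remQuot; _↑ˡ_; _↑ʳ_; _≟_)
open import Data.Fin.Properties using (remQuot-combine; combine-remQuot; suc-injective; 0≢1+n)
open import Data.Fin.Subset using (Subset; ∣_∣; _∩_; _∈_; Nonempty)
open import Data.Bool using (Bool; true; false; not; _∧_; _∨_)
open import Data.Bool.Properties using (∧-identityʳ; ∧-zeroʳ; ∨-zeroʳ; ∧-conicalˡ; ∧-conicalʳ; not-injective)
open import Data.Vec using ([]; _∷_; lookup; tabulate)
open import Data.Vec.Properties using ([]=⇒lookup; lookup⇒[]=; lookup∘tabulate; lookup-zipWith)
open import Data.Product using (Σ; _×_; _,_; ∃; proj₁; proj₂)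
open import Data.Sum using (_⊎_; inj₁; inj₂)
open import Function using (_∘_)
open import Relation.Nullary using (yes; no)
open import Relation.Nullary.Decidable using (⌊_⌋; isYes≗does; dec-true; dec-false)
open import Relation.Binary.PropositionalEquality
open import Algebra.Properties.CommutativeMonoid.Sum +-0-commutativeMonoid
  using (sum; sum-cong-≗; ∑-distrib-+; sum-replicate-zero)

sum-mono : ∀ {n} (f g : Fin n → ℕ) → (∀ x → f x ≤ g x) → sum f ≤ sum g
sum-mono {zero}  f g f≤g = z≤n
sum-mono {suc n} f g f≤g = +-mono-≤ (f≤g zero) (sum-mono (f ∘ suc) (g ∘ suc) (f≤g ∘ suc))

sum-↑ : ∀ p {q} (f : Fin (p + q) → ℕ) →
  sum f ≡ sum (λ x → f (x ↑ˡ q)) + sum (λ y → f (p ↑ʳ y))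
sum-↑ zero    f = refl
sum-↑ (suc p) f = trans (cong (f zero +_) (sum-↑ p (f ∘ suc))) (sym (+-assoc (f zero) _ _))

sum-grid : ∀ m r (f : Fin (m * r) → ℕ) →
  sum f ≡ sum (λ a → sum (λ j → f (combine {m} {r} a j)))
sum-grid zero    r f = refl
sum-grid (suc m) r f =
  trans (sum-↑ r f) (cong (sum (λ j → f (j ↑ˡ (m * r))) +_) (sum-grid m r (λ y → f (r ↑ʳ y))))

indicator : Bool → ℕ
indicator true  = 1
indicator false = 0

count : ∀ {n} → (Fin n → Bool) → ℕ
count f = sum (indicator ∘ f)

count-cong : ∀ {n} {f g : Fin n → Bool} → (∀ x → f x ≡ g x) → count f ≡ count g
count-cong f≗g = sum-cong-≗ (cong indicator ∘ f≗g)

∣∣≡count : ∀ {n} (p : Subset n) → ∣ p ∣ ≡ count (lookup p)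
∣∣≡count []          = refl
∣∣≡count (true ∷ p)  = cong suc (∣∣≡count p)
∣∣≡count (false ∷ p) = ∣∣≡count p

∣tabulate∣ : ∀ {n} (f : Fin n → Bool) → ∣ tabulate f ∣ ≡ count f
∣tabulate∣ f = trans (∣∣≡count (tabulate f)) (count-cong (lookup∘tabulate f))

count-true : ∀ n → count {n} (λ _ → true) ≡ n
count-true zero    = refl
count-true (suc n) = cong suc (count-true n)

count-false : ∀ n → count {n} (λ _ → false) ≡ 0
count-false zero    = refl
count-false (suc n) = count-false n

count-none : ∀ {n} (f : Fin n → Bool) → (∀ x → f x ≡ false) → count f ≡ 0
count-none {zero}  f none = refl
count-none {suc n} f none rewrite none zero = count-none (f ∘ suc) (none ∘ suc)

count-additive : ∀ {n} (f g h k : Fin n → Bool) →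
  (∀ x → indicator (f x) + indicator (g x) ≡ indicator (h x) + indicator (k x)) →
  count f + count g ≡ count h + count k
count-additive f g h k pointwise = begin
  count f + count g                             ≡⟨ ∑-distrib-+ (indicator ∘ f) (indicator ∘ g) ⟨
  sum (λ x → indicator (f x) + indicator (g x)) ≡⟨ sum-cong-≗ pointwise ⟩
  sum (λ x → indicator (h x) + indicator (k x)) ≡⟨ ∑-distrib-+ (indicator ∘ h) (indicator ∘ k) ⟩
  count h + count k                             ∎
  where open ≡-Reasoning

count-∧∨ : ∀ {n} (f g : Fin n → Bool) →
  count (λ x → f x ∧ g x) + count (λ x → f x ∨ g x) ≡ count f + count g
count-∧∨ f g = count-additive _ _ f g (λ x → pointwise (f x) (g x))
  where
  pointwise : ∀ a b → indicator (a ∧ b) + indicator (a ∨ b) ≡ indicator a + indicator b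
  pointwise true  b     = +-comm (indicator b) 1
  pointwise false true  = refl
  pointwise false false = refl

count-split : ∀ {n} (f g : Fin n → Bool) →
  count (λ x → f x ∧ g x) + count (λ x → f x ∧ not (g x)) ≡ count f
count-split {n} f g = trans (count-additive _ _ f (λ _ → false) (λ x → pointwise (f x) (g x)))
                            (trans (cong (count f +_) (count-false n)) (+-identityʳ _))
  where
  pointwise : ∀ a b → indicator (a ∧ b) + indicator (a ∧ not b) ≡ indicator a + 0
  pointwise true  true  = refl
  pointwise true  false = refl
  pointwise false b     = refl

count-complement : ∀ n (f : Fin n → Bool) → count f + count (not ∘ f) ≡ n
count-complement n f = trans (count-additive f (not ∘ f) (λ _ → true) (λ _ → false)
                                             (λ x → pointwise (f x)))
                             (trans (cong₂ _+_ (count-true n) (count-false n))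
                                    (+-identityʳ n))
  where
  pointwise : ∀ a → indicator a + indicator (not a) ≡ 1 + 0
  pointwise true  = refl
  pointwise false = refl

count-mono : ∀ {n} (f g : Fin n → Bool) → (∀ x → f x ≡ true → g x ≡ true) → count f ≤ count g
count-mono f g f⇒g = sum-mono _ _ (λ x → pointwise (f x) (g x) (f⇒g x))
  where
  pointwise : ∀ a b → (a ≡ true → b ≡ true) → indicator a ≤ indicator b
  pointwise true  b     a⇒b rewrite a⇒b refl = ≤-refl
  pointwise false b     _   = z≤n

count-≤ : ∀ n (f : Fin n → Bool) → count f ≤ n
count-≤ n f = ≤-trans (count-mono f (λ _ → true) (λ _ _ → refl)) (≤-reflexive (count-true n))

singleton : ∀ {n} → Fin n → Fin n → Bool
singleton x y = ⌊ y ≟ x ⌋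

singleton-self : ∀ {n} (x : Fin n) → singleton x x ≡ true
singleton-self x = trans (isYes≗does (x ≟ x)) (dec-true (x ≟ x) refl)

singleton-sound : ∀ {n} {x y : Fin n} → singleton x y ≡ true → y ≡ x
singleton-sound {x = x} {y} eq with y ≟ x
... | yes y≡x = y≡x

singleton-other : ∀ {n} {x y : Fin n} → y ≢ x → singleton x y ≡ false
singleton-other {x = x} {y} y≢x = trans (isYes≗does (y ≟ x)) (dec-false (y ≟ x) y≢x)

singleton-suc : ∀ {n} (x y : Fin n) → singleton (suc x) (suc y) ≡ singleton x y
singleton-suc x y with y ≟ x
... | yes _ = refl
... | no  _ = refl

count-singleton : ∀ {n} (x : Fin n) → count (singleton x) ≡ 1
count-singleton {suc n} zero    = cong suc (count-none {n} (singleton zero ∘ suc) (λ _ → refl))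
count-singleton {suc n} (suc x) = trans (count-cong (singleton-suc x)) (count-singleton x)

count-pos : ∀ {n} (f : Fin n → Bool) (x : Fin n) → f x ≡ true → 1 ≤ count f
count-pos f x fx = begin
  1                    ≡⟨ count-singleton x ⟨
  count (singleton x)  ≤⟨ count-mono (singleton x) f (λ y sxy → subst (λ z → f z ≡ true) (sym (singleton-sound sxy)) fx) ⟩
  count f              ∎
  where open ≤-Reasoning

count-witness : ∀ {n} (f : Fin n → Bool) → 1 ≤ count f → ∃ λ x → f x ≡ true
count-witness {suc n} f pos with f zero in f0
... | true  = zero , f0
... | false = let (x , fx) = count-witness (f ∘ suc) pos in suc x , fx

count-remove : ∀ {n} (f : Fin n → Bool) (x : Fin n) → f x ≡ true →
  suc (count (λ y → f y ∧ not (singleton x y))) ≡ count f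
count-remove f x fx = begin
  suc rest                                 ≡⟨ cong (_+ rest) (count-singleton x) ⟨
  count (singleton x) + rest               ≡⟨ cong (_+ rest) (count-cong on-x) ⟨
  count (λ y → f y ∧ singleton x y) + rest ≡⟨ count-split f (singleton x) ⟩
  count f                                  ∎
  where
  open ≡-Reasoning
  rest : ℕ
  rest = count (λ y → f y ∧ not (singleton x y))
  on-x : ∀ y → f y ∧ singleton x y ≡ singleton x y
  on-x y with singleton x y in sxy
  ... | false = ∧-zeroʳ (f y)
  ... | true  = trans (∧-identityʳ (f y)) (subst (λ z → f z ≡ true) (sym (singleton-sound sxy)) fx)

count-overlap : ∀ n (f g : Fin n → Bool) → count f + count g ∸ n ≤ count (λ x → f x ∧ g x)
count-overlap n f g = m≤n+o⇒m∸n≤o (count f + count g) n (begin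
  count f + count g                                 ≡⟨ count-∧∨ f g ⟨
  count (λ x → f x ∧ g x) + count (λ x → f x ∨ g x) ≤⟨ +-monoʳ-≤ _ (count-≤ n _) ⟩
  count (λ x → f x ∧ g x) + n                       ≡⟨ +-comm _ n ⟩
  n + count (λ x → f x ∧ g x)                       ∎)
  where open ≤-Reasoning

choose : ∀ {n} (A : Fin n → Bool) k → k ≤ count A →
  Σ (Fin n → Bool) λ Z → (∀ x → Z x ≡ true → A x ≡ true) × count Z ≡ k
choose {n} A zero _ = (λ _ → false) , (λ _ ()) , count-false n
choose {suc n} A (suc k) k<A with A zero in A0
... | true  = let (Z , Z⊆A , ∣Z∣) = choose (A ∘ suc) k (≤-pred k<A) in
  (λ { zero → true ; (suc x) → Z x }) , (λ { zero _ → A0 ; (suc x) → Z⊆A x }) , cong suc ∣Z∣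
... | false = let (Z , Z⊆A , ∣Z∣) = choose (A ∘ suc) (suc k) k<A in
  (λ { zero → false ; (suc x) → Z x }) , (λ { zero () ; (suc x) → Z⊆A x }) , ∣Z∣

pigeonhole : ∀ {n m} (X : Fin n → Bool) (B : Fin m → Bool)
  (g : ∀ x → X x ≡ true → Fin m) →
  (∀ x p → B (g x p) ≡ true) →
  (∀ x y p q → g x p ≡ g y q → x ≡ y) →
  count X ≤ count B
pigeonhole {zero} X B g g∈B g-inj = z≤n
pigeonhole {suc n} X B g g∈B g-inj with X zero in X0
... | false = pigeonhole (X ∘ suc) B (g ∘ suc) (g∈B ∘ suc)
                (λ x y p q eq → suc-injective (g-inj _ _ p q eq))
... | true  = subst (suc (count (X ∘ suc)) ≤_) (count-remove B (g zero X0) (g∈B zero X0))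
                (s≤s (pigeonhole (X ∘ suc) B′ (g ∘ suc) g∈B′
                        (λ x y p q eq → suc-injective (g-inj _ _ p q eq))))
  where
  B′ : _ → Bool
  B′ y = B y ∧ not (singleton (g zero X0) y)
  g∈B′ : ∀ x p → B′ (g (suc x) p) ≡ true
  g∈B′ x p rewrite g∈B (suc x) p
                 | singleton-other {x = g zero X0} (λ eq → 0≢1+n (sym (g-inj _ _ p X0 eq))) = refl

isPositive : ℕ → Bool
isPositive zero    = false
isPositive (suc _) = true

count-positive≤sum : ∀ {n} (h : Fin n → ℕ) → count (isPositive ∘ h) ≤ sum h
count-positive≤sum h = sum-mono _ h (λ x → pointwise (h x))
  where
  pointwise : ∀ k → indicator (isPositive k) ≤ k
  pointwise zero    = z≤n
  pointwise (suc k) = s≤s z≤n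

isPositive-true : ∀ {n} → 1 ≤ n → isPositive n ≡ true
isPositive-true (s≤s _) = refl

-- The subset of the grid Fin m × Fin r, encoded in Fin (m * r) via remQuot, given by
-- a predicate on (row, column); Hrl builds its edges this way.
gridSet : ∀ {m} r → (Fin m → Fin r → Bool) → Subset (m * r)
gridSet {m} r F = tabulate (λ v → F (proj₁ (remQuot {m} r v)) (proj₂ (remQuot {m} r v)))

row : ∀ {m r} → Subset (m * r) → Fin m → Fin r → Bool
row {m} {r} p a j = lookup p (combine a j)

row-gridSet : ∀ {m r} (F : Fin m → Fin r → Bool) (a : Fin m) (j : Fin r) → row (gridSet r F) a j ≡ F a j
row-gridSet {m} {r} F a j =
  trans (lookup∘tabulate _ (combine a j)) (cong (λ (b , k) → F b k) (remQuot-combine a j))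

row-∩ : ∀ {m r} (p q : Subset (m * r)) (a : Fin m) (j : Fin r) → row (p ∩ q) a j ≡ row p a j ∧ row q a j
row-∩ p q a j = lookup-zipWith _∧_ (combine a j) p q

∣∣-by-rows : ∀ m r (p : Subset (m * r)) → ∣ p ∣ ≡ sum (λ (a : Fin m) → count (row {m} {r} p a))
∣∣-by-rows m r p = trans (∣∣≡count p) (sum-grid m r (indicator ∘ lookup p))

row-witness : ∀ {m r} (p : Subset (m * r)) → Nonempty p →
  ∃ λ (a : Fin m) → ∃ λ (j : Fin r) → row p a j ≡ true
row-witness {m} {r} p (v , v∈p) with remQuot {m} r v in v≡aj
... | a , j = a , j , []=⇒lookup (subst (λ w → w ∈ p) (sym decode) v∈p)
  where
  decode : combine a j ≡ v
  decode = trans (cong (λ (b , k) → combine b k) (sym v≡aj)) (combine-remQuot {m} r v)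

nonempty-at : ∀ {m r} (p : Subset (m * r)) (a : Fin m) (j : Fin r) → row p a j ≡ true → Nonempty p
nonempty-at p a j paj = combine a j , lookup⇒[]= (combine a j) p paj

-- For ℓ ≤ r, the bound r ∸ 2ℓ is |S| + |S′| ∸ r for two (r ∸ ℓ)-subsets S, S′ of [r].
overlap-bound : ∀ r ℓ → ℓ ≤ r → r ∸ 2 * ℓ ≡ (r ∸ ℓ) + (r ∸ ℓ) ∸ r
overlap-bound r ℓ ℓ≤r = begin
  r ∸ 2 * ℓ                         ≡⟨ cong (r ∸_) (cong (ℓ +_) (+-identityʳ ℓ)) ⟩
  r ∸ (ℓ + ℓ)                       ≡⟨ ∸-+-assoc r ℓ ℓ ⟨
  (r ∸ ℓ) ∸ ℓ                       ≡⟨ [m+n]∸[m+o]≡n∸o (r ∸ ℓ) (r ∸ ℓ) ℓ ⟨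
  (r ∸ ℓ) + (r ∸ ℓ) ∸ ((r ∸ ℓ) + ℓ) ≡⟨ cong ((r ∸ ℓ) + (r ∸ ℓ) ∸_) (m∸n+n≡m ℓ≤r) ⟩
  (r ∸ ℓ) + (r ∸ ℓ) ∸ r             ∎
  where open ≡-Reasoning

-- The hypergraph H = H^r_ℓ for a family S of subsets of [r]; its edges are
-- gridSet (inEdge S i), so row 0 of e_i is S_i and row i+1 is its complement.
module _ (r m : ℕ) (S : Fin m → Subset r) where

  private
    H : Hypergraph
    H = Hrl r m S

    E : Fin m → Subset (suc m * r)
    E = edge H

    rowOf : Subset (suc m * r) → Fin (suc m) → Fin r → Bool
    rowOf = row

  onRowZero : (Fin r → Bool) → Fin (suc m) → Fin r → Bool
  onRowZero T zero    j = T j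
  onRowZero T (suc _) j = false

  rowZeroSet : (Fin r → Bool) → Subset (suc m * r)
  rowZeroSet T = gridSet {suc m} r (onRowZero T)

  ∣rowZeroSet∣ : ∀ T → ∣ rowZeroSet T ∣ ≡ count T
  ∣rowZeroSet∣ T = begin
    ∣ rowZeroSet T ∣                                          ≡⟨ ∣∣-by-rows (suc m) r (rowZeroSet T) ⟩
    sum (λ a → count (rowOf (rowZeroSet T) a))               ≡⟨ sum-cong-≗ (λ a → count-cong (row-gridSet (onRowZero T) a)) ⟩
    count T + sum (λ (_ : Fin m) → count {r} (λ _ → false))  ≡⟨ cong (count T +_) (sum-cong-≗ {m} (λ _ → count-false r)) ⟩
    count T + sum (λ (_ : Fin m) → 0)                         ≡⟨ cong (count T +_) (sum-replicate-zero m) ⟩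
    count T + 0                                               ≡⟨ +-identityʳ _ ⟩
    count T                                                   ∎
    where open ≡-Reasoning

  edge-row : ∀ i a j → rowOf (E i) a j ≡ inEdge S i a j
  edge-row i = row-gridSet (inEdge S i)

  ∩edge-row₀ : ∀ p i j → rowOf (p ∩ E i) zero j ≡ rowOf p zero j ∧ lookup (S i) j
  ∩edge-row₀ p i j = trans (row-∩ {suc m} p (E i) zero j) (cong (rowOf p zero j ∧_) (edge-row i zero j))

  edge-overlap : ∀ i k → count (λ j → lookup (S i) j ∧ lookup (S k) j) ≤ ∣ E i ∩ E k ∣
  edge-overlap i k = begin
    count (λ j → lookup (S i) j ∧ lookup (S k) j) ≡⟨ count-cong row₀ ⟨
    count (rowOf (E i ∩ E k) zero)                ≤⟨ m≤m+n _ _ ⟩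
    sum (λ a → count (rowOf (E i ∩ E k) a))       ≡⟨ ∣∣-by-rows (suc m) r (E i ∩ E k) ⟨
    ∣ E i ∩ E k ∣                                 ∎
    where
    open ≤-Reasoning
    row₀ : ∀ j → rowOf (E i ∩ E k) zero j ≡ lookup (S i) j ∧ lookup (S k) j
    row₀ j = trans (∩edge-row₀ (E i) k j) (cong (_∧ lookup (S k) j) (edge-row i zero j))

  intersecting : ∀ ℓ → ℓ ≤ r → (∀ i → ∣ S i ∣ ≡ r ∸ ℓ) → Intersecting (r ∸ 2 * ℓ) H
  intersecting ℓ ℓ≤r ∣S∣ i k = begin
    r ∸ 2 * ℓ                                         ≡⟨ overlap-bound r ℓ ℓ≤r ⟩
    (r ∸ ℓ) + (r ∸ ℓ) ∸ r                             ≡⟨ cong₂ (λ a b → a + b ∸ r) (size i) (size k) ⟩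
    count (lookup (S i)) + count (lookup (S k)) ∸ r   ≤⟨ count-overlap r (lookup (S i)) (lookup (S k)) ⟩
    count (λ j → lookup (S i) j ∧ lookup (S k) j)     ≤⟨ edge-overlap i k ⟩
    ∣ E i ∩ E k ∣                                     ∎
    where
    open ≤-Reasoning
    size : ∀ i → r ∸ ℓ ≡ count (lookup (S i))
    size i = trans (sym (∣S∣ i)) (∣∣≡count (S i))

  -- Any ℓ + 1 points of row 0 cover H, since an (ℓ+1)-set and an (r∸ℓ)-set in [r] meet.
  small-cover : ∀ ℓ → ℓ < r → (∀ i → ∣ S i ∣ ≡ r ∸ ℓ) →
    Σ (Subset (suc m * r)) λ C → IsCover H C × ∣ C ∣ ≡ suc ℓ
  small-cover ℓ ℓ<r ∣S∣ = R₀ , covers , trans (∣rowZeroSet∣ T) ∣T∣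
    where
    chosen : Σ (Fin r → Bool) λ T → (∀ j → T j ≡ true → true ≡ true) × count T ≡ suc ℓ
    chosen = choose (λ _ → true) (suc ℓ) (subst (suc ℓ ≤_) (sym (count-true r)) ℓ<r)
    T : Fin r → Bool
    T = proj₁ chosen
    ∣T∣ : count T ≡ suc ℓ
    ∣T∣ = proj₂ (proj₂ chosen)
    R₀ : Subset (suc m * r)
    R₀ = rowZeroSet T
    meets : ∀ i → 1 ≤ count (λ j → T j ∧ lookup (S i) j)
    meets i = begin
      1                                        ≡⟨ m+n∸n≡m 1 r ⟨
      suc r ∸ r                                ≡⟨ cong (λ x → suc x ∸ r) (m+[n∸m]≡n (<⇒≤ ℓ<r)) ⟨
      suc ℓ + (r ∸ ℓ) ∸ r                      ≡⟨ cong₂ (λ a b → a + b ∸ r) (sym ∣T∣) (trans (sym (∣S∣ i)) (∣∣≡count (S i))) ⟩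
      count T + count (lookup (S i)) ∸ r       ≤⟨ count-overlap r T (lookup (S i)) ⟩
      count (λ j → T j ∧ lookup (S i) j)       ∎
      where open ≤-Reasoning
    covers : IsCover H R₀
    covers i = let (j , T∩Sᵢ) = count-witness _ (meets i) in
      nonempty-at {suc m} (R₀ ∩ E i) zero j
        (trans (∩edge-row₀ R₀ i j)
          (trans (cong (_∧ lookup (S i) j) (row-gridSet (onRowZero T) zero j)) T∩Sᵢ))

  module NoSmallCover (ℓ : ℕ) (ℓ<r : ℓ < r)
    (onto : ∀ T → ∣ T ∣ ≡ r ∸ ℓ → ∃ λ i → S i ≡ T)
    (K : Subset (suc m * r)) (cover : IsCover H K) where

    K₀ : Fin r → Bool
    K₀ = rowOf K zero

    t : ℕ
    t = count K₀

    -- Whether K meets row i + 1, which belongs to e_i alone.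
    hits : Fin m → Bool
    hits i = isPositive (count (rowOf K (suc i)))

    -- K has t points in row 0 and at least one in every hit row.
    size-bound : t + count hits ≤ ∣ K ∣
    size-bound = begin
      t + count hits                          ≤⟨ +-monoʳ-≤ t (count-positive≤sum (λ i → count (rowOf K (suc i)))) ⟩
      t + sum (λ i → count (rowOf K (suc i))) ≡⟨ ∣∣-by-rows (suc m) r K ⟨
      ∣ K ∣                                   ∎
      where open ≤-Reasoning

    meets : ∀ i → (∃ λ j → K₀ j ∧ lookup (S i) j ≡ true) ⊎ hits i ≡ true
    meets i with row-witness {suc m} (K ∩ E i) (cover i)
    ... | zero  , j , p = inj₁ (j , trans (sym (∩edge-row₀ K i j)) p)
    ... | suc k , j , p = inj₂ (subst (λ k → hits k ≡ true) k≡i (isPositive-true (count-pos _ j K∋kj)))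
      where
      in-row : rowOf K (suc k) j ∧ (⌊ k ≟ i ⌋ ∧ not (lookup (S i) j)) ≡ true
      in-row = trans (sym (trans (row-∩ {suc m} K (E i) (suc k) j)
                                 (cong (rowOf K (suc k) j ∧_) (edge-row i (suc k) j)))) p
      K∋kj : rowOf K (suc k) j ≡ true
      K∋kj = ∧-conicalˡ _ _ in-row
      k≡i : k ≡ i
      k≡i = singleton-sound (∧-conicalˡ (singleton i k) _ (∧-conicalʳ (rowOf K (suc k) j) _ in-row))

    avoiding⇒hit : ∀ i → (∀ j → lookup (S i) j ≡ true → K₀ j ≡ false) → hits i ≡ true
    avoiding⇒hit i avoids with meets i
    ... | inj₂ hit      = hit
    ... | inj₁ (j , p) with trans (sym (∧-conicalˡ _ _ p)) (avoids j (∧-conicalʳ _ _ p))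
    ... | ()

    A : Fin r → Bool
    A = not ∘ K₀

    A⇒missed : ∀ j → A j ≡ true → K₀ j ≡ false
    A⇒missed j Aj = not-injective Aj

    -- When t ≤ ℓ, K hits at least ℓ + 1 ∸ t private rows: fix d = r ∸ (ℓ + 1) missed
    -- points Z; each further missed point x gives the edge with S_i = Z ∪ {x}.
    module _ (t≤ℓ : t ≤ ℓ) where

      d : ℕ
      d = r ∸ suc ℓ

      t+A : t + count A ≡ r
      t+A = count-complement r K₀

      d+ℓ : d + suc ℓ ≡ r
      d+ℓ = m∸n+n≡m ℓ<r

      d≤A : d ≤ count A
      d≤A = +-cancelʳ-≤ t d (count A) (begin
        d + t          ≤⟨ +-monoʳ-≤ d (m≤n⇒m≤1+n t≤ℓ) ⟩
        d + suc ℓ      ≡⟨ d+ℓ ⟩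
        r              ≡⟨ t+A ⟨
        t + count A    ≡⟨ +-comm t (count A) ⟩
        count A + t    ∎)
        where open ≤-Reasoning

      chosen : Σ (Fin r → Bool) λ Z → (∀ j → Z j ≡ true → A j ≡ true) × count Z ≡ d
      chosen = choose A d d≤A

      Z : Fin r → Bool
      Z = proj₁ chosen

      Z⊆A : ∀ j → Z j ≡ true → A j ≡ true
      Z⊆A = proj₁ (proj₂ chosen)

      ∣Z∣ : count Z ≡ d
      ∣Z∣ = proj₂ (proj₂ chosen)

      X : Fin r → Bool
      X j = A j ∧ not (Z j)

      X⇒A : ∀ {x} → X x ≡ true → A x ≡ true
      X⇒A = ∧-conicalˡ _ _

      X⇒∉Z : ∀ {x} → X x ≡ true → Z x ≡ false
      X⇒∉Z Xx = not-injective (∧-conicalʳ _ _ Xx)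

      t+X : t + count X ≡ suc ℓ
      t+X = +-cancelˡ-≡ d _ _ (begin
        d + (t + count X) ≡⟨ +-assoc d t (count X) ⟨
        d + t + count X   ≡⟨ cong (_+ count X) (+-comm d t) ⟩
        t + d + count X   ≡⟨ +-assoc t d (count X) ⟩
        t + (d + count X) ≡⟨ cong (t +_) d+X ⟩
        t + count A       ≡⟨ t+A ⟩
        r                 ≡⟨ d+ℓ ⟨
        d + suc ℓ         ∎)
        where
        open ≡-Reasoning
        A∧Z≗Z : ∀ j → A j ∧ Z j ≡ Z j
        A∧Z≗Z j with Z j in Zj
        ... | false = ∧-zeroʳ (A j)
        ... | true  = trans (∧-identityʳ (A j)) (Z⊆A j Zj)
        d+X : d + count X ≡ count A
        d+X = trans (cong (_+ count X) (trans (sym ∣Z∣) (sym (count-cong A∧Z≗Z)))) (count-split A Z)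

      Z+ : Fin r → Fin r → Bool
      Z+ x j = Z j ∨ singleton x j

      ∣Z+∣ : ∀ x → X x ≡ true → count (Z+ x) ≡ r ∸ ℓ
      ∣Z+∣ x Xx = begin
        count (Z+ x)                                    ≡⟨ cong (_+ count (Z+ x)) (count-none _ disjoint) ⟨
        count (λ j → Z j ∧ singleton x j) + count (Z+ x) ≡⟨ count-∧∨ Z (singleton x) ⟩
        count Z + count (singleton x)                   ≡⟨ cong₂ _+_ ∣Z∣ (count-singleton x) ⟩
        d + 1                                           ≡⟨ +-comm d 1 ⟩
        suc d                                           ≡⟨ +-∸-assoc 1 ℓ<r ⟨
        r ∸ ℓ                                           ∎
        where
        open ≡-Reasoning
        disjoint : ∀ j → Z j ∧ singleton x j ≡ false
        disjoint j with singleton x j in x≡j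
        ... | false = ∧-zeroʳ (Z j)
        ... | true  = trans (∧-identityʳ (Z j))
                            (subst (λ y → Z y ≡ false) (sym (singleton-sound x≡j)) (X⇒∉Z Xx))

      Z+-missed : ∀ x → X x ≡ true → ∀ j → Z+ x j ≡ true → K₀ j ≡ false
      Z+-missed x Xx j Z+xj with Z j in Zj
      ... | true  = A⇒missed j (Z⊆A j Zj)
      ... | false = subst (λ y → K₀ y ≡ false) (sym (singleton-sound Z+xj)) (A⇒missed x (X⇒A Xx))

      found : ∀ x → X x ≡ true → ∃ λ i → S i ≡ tabulate (Z+ x)
      found x Xx = onto (tabulate (Z+ x)) (trans (∣tabulate∣ (Z+ x)) (∣Z+∣ x Xx))

      index : ∀ x → X x ≡ true → Fin m
      index x Xx = proj₁ (found x Xx)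

      index-set : ∀ x Xx j → lookup (S (index x Xx)) j ≡ Z+ x j
      index-set x Xx j = trans (cong (λ T → lookup T j) (proj₂ (found x Xx))) (lookup∘tabulate (Z+ x) j)

      index-hits : ∀ x Xx → hits (index x Xx) ≡ true
      index-hits x Xx = avoiding⇒hit (index x Xx)
        (λ j p → Z+-missed x Xx j (trans (sym (index-set x Xx j)) p))

      -- Z ∪ {x} determines x, as x ∉ Z.
      index-injective : ∀ x y Xx Xy → index x Xx ≡ index y Xy → x ≡ y
      index-injective x y Xx Xy same = singleton-sound (begin
        singleton y x                      ≡⟨ cong (_∨ singleton y x) (X⇒∉Z Xx) ⟨
        Z+ y x                             ≡⟨ index-set y Xy x ⟨
        lookup (S (index y Xy)) x          ≡⟨ cong (λ i → lookup (S i) x) same ⟨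
        lookup (S (index x Xx)) x          ≡⟨ index-set x Xx x ⟩
        Z x ∨ singleton x x                ≡⟨ cong (Z x ∨_) (singleton-self x) ⟩
        Z x ∨ true                         ≡⟨ ∨-zeroʳ (Z x) ⟩
        true                               ∎)
        where open ≡-Reasoning

      enough-rows : suc ℓ ≤ t + count hits
      enough-rows = begin
        suc ℓ           ≡⟨ t+X ⟨
        t + count X     ≤⟨ +-monoʳ-≤ t (pigeonhole X hits index index-hits index-injective) ⟩
        t + count hits  ∎
        where open ≤-Reasoning

    bound : suc ℓ ≤ ∣ K ∣
    bound with t ≤? ℓ
    ... | yes t≤ℓ = ≤-trans (enough-rows t≤ℓ) size-bound
    ... | no  t≰ℓ = ≤-trans (≰⇒> t≰ℓ) (≤-trans (m≤m+n t (count hits)) size-bound)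

ℓ<r : ∀ r ℓ → 1 ≤ r → ℓ ≤ ⌊ (r ∸ 1) /2⌋ → ℓ < r
ℓ<r (suc r) ℓ _ ℓ≤ = s≤s (≤-trans ℓ≤ (⌊n/2⌋≤n r))

proposition2p2 : (r ℓ : ℕ) → 1 ≤ r → ℓ ≤ ⌊ (r ∸ 1) /2⌋
    → (S : Fin (r C (r ∸ ℓ)) → Subset r)
    → IsEnumeration r (r ∸ ℓ) (r C (r ∸ ℓ)) S
    → Intersecting (r ∸ 2 * ℓ) (Hrl r (r C (r ∸ ℓ)) S)
    × CoverNumberIs (Hrl r (r C (r ∸ ℓ)) S) (suc ℓ)
proposition2p2 r ℓ 1≤r ℓ≤⌊r-1/2⌋ S (_ , ∣S∣ , onto) =
  intersecting r m S ℓ (<⇒≤ ℓ<r′) ∣S∣ ,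
  small-cover r m S ℓ ℓ<r′ ∣S∣ ,
  NoSmallCover.bound r m S ℓ ℓ<r′ onto
  where
  m : ℕ
  m = r C (r ∸ ℓ)
  ℓ<r′ : ℓ < r
  ℓ<r′ = ℓ<r r ℓ 1≤r ℓ≤⌊r-1/2⌋
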